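{- Let $\Gamma$ be a semicomplete multipartite commutative weakly distance-regular digraph. Then all partite sets of the underlying graph of $\Gamma$ have the same size; that is, the underlying graph is isomorphic to the complete multipartite graph $K^k_m$ with $k\ge 2$ parts each of size $m\geq 2$.
   Context: A digraph has a finite vertex set and arcs that are ordered pairs of distinct vertices. $\partial(x,y)$ is the length of a shortest directed path from $x$ to $y$; strongly connected means all are finite. $\tilde\partial(x,y)=(\partial(x,y),\partial(y,x))$, $\tilde\partial(\Gamma)$ the set of these pairs, $\Gamma_{\tilde i}=\{(x,y):\tilde\partial(x,y)=\tilde i\}$. A strongly connected $\Gamma$ is weakly distance-regular if its arc relation is not symmetric and for all $\tilde i,\tilde j,\tilde h\in\tilde\partial(\Gamma)$ the number $|\{z:(x,z)\in\Gamma_{\tilde i},(z,y)\in\Gamma_{\tilde j}\}|$ is the same for all $(x,y)\in\Gamma_{\tilde h}$; commutative if this number is symmetric in $\tilde i,\tilde j$. $\Gamma$ is semicomplete multipartite if its underlying graph ($x\sim y$ iff $(x,y)$ or $(y,x)$ is an arc) is a complete multipartite graph with at least 2 parts (partite sets), each of size at least 2. -}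

module Defs where

open import Data.Nat using (ℕ; zero; suc; _≡ᵇ_; _≤_)
open import Data.Bool using (Bool; true; false; _∧_; _∨_; not; if_then_else_)
open import Data.Fin using (Fin; _≟_)
open import Data.List using (List; filter; length; allFin)
open import Data.Bool.ListAction using (any)
open import Data.Product using (Σ; _×_; _,_; ∃)
open import Relation.Nullary using (¬_; ⌊_⌋)
open import Relation.Binary.PropositionalEquality using (_≡_; _≢_)

record Digraph (n : ℕ) : Set where
  field
    arc   : Fin n → Fin n → Bool
    loopless : ∀ x → arc x x ≡ false
open Digraph public

module _ {n : ℕ} (Γ : Digraph n) where

  data Walk : Fin n → Fin n → ℕ → Set where
    here : ∀ x → Walk x x zero
    step : ∀ {x y z k} → arc Γ x y ≡ true → Walk y z k → Walk x z (suc k)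

  StronglyConnected : Set
  StronglyConnected = ∀ x y → ∃ λ k → Walk x y k

  reachIn : ℕ → Fin n → Fin n → Bool
  reachIn zero x y = ⌊ x ≟ y ⌋
  reachIn (suc k) x y = reachIn k x y ∨ any (λ z → reachIn k x z ∧ arc Γ z y) (allFin n)

  -- least k in [j, j + fuel] with reachIn k x y; returns j + fuel if none
  private
    search : ℕ → ℕ → Fin n → Fin n → ℕ
    search j zero x y = j
    search j (suc f) x y = if reachIn j x y then j else search (suc j) f x y

  -- ∂(x,y): length of a shortest directed path from x to y
  -- (a shortest walk is a path, of length < n; the value n means "unreachable",
  --  which never occurs for strongly connected digraphs)
  ∂ : Fin n → Fin n → ℕ
  ∂ x y = search 0 n x y

  ∂̃ : Fin n → Fin n → ℕ × ℕ
  ∂̃ x y = (∂ x y , ∂ y x)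

  _≡ᵖ_ : ℕ × ℕ → ℕ × ℕ → Bool
  (a , b) ≡ᵖ (c , d) = (a ≡ᵇ c) ∧ (b ≡ᵇ d)

  count : (Fin n → Bool) → ℕ
  count P = length (filter (λ z → P z ≟ᵇ true) (allFin n))
    where
    open import Data.Bool.Properties using () renaming (_≟_ to _≟ᵇ_)

  p : ℕ × ℕ → ℕ × ℕ → Fin n → Fin n → ℕ
  p i j x y = count (λ z → (∂̃ x z ≡ᵖ i) ∧ (∂̃ z y ≡ᵖ j))

  -- ĩ, j̃ range over ∂̃(Γ), i.e. realised as ∂̃(u,v) and ∂̃(u',v')
  WeaklyDistanceRegular : Set
  WeaklyDistanceRegular =
    StronglyConnected
    × (∃ λ x → ∃ λ y → arc Γ x y ≡ true × arc Γ y x ≡ false)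
    × (∀ u v u' v' x y x' y' → ∂̃ x y ≡ ∂̃ x' y' →
         p (∂̃ u v) (∂̃ u' v') x y ≡ p (∂̃ u v) (∂̃ u' v') x' y')

  Commutative : Set
  Commutative = ∀ u v u' v' x y →
    p (∂̃ u v) (∂̃ u' v') x y ≡ p (∂̃ u' v') (∂̃ u v) x y

  Adj : Fin n → Fin n → Set
  Adj x y = (arc Γ x y ∨ arc Γ y x) ≡ true

  IsMultipartition : (k : ℕ) → (Fin n → Fin k) → Set
  IsMultipartition k part =
    2 ≤ k
    × (∀ a → ∃ λ x → ∃ λ y → x ≢ y × part x ≡ a × part y ≡ a)
    × (∀ x y → (Adj x y → part x ≢ part y) × (part x ≢ part y → Adj x y))

  SemicompleteMultipartite : Set
  SemicompleteMultipartite = ∃ λ k → Σ (Fin n → Fin k) (IsMultipartition k)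

  partSize : {k : ℕ} → (Fin n → Fin k) → Fin k → ℕ
  partSize part a = count (λ x → ⌊ part x ≟ a ⌋)

{-# OPTIONS --safe #-}
module Submission where

-- In a weakly distance-regular digraph the number of z with ∂̃(x,z) = ĩ is the intersection
-- number p^{(0,0)}_{ĩ,ĩᵀ}(x,x), so it does not depend on x; peeling off one value ĩ at a time,
-- neither does the number of z with ∂̃(x,z) in any fixed set of pairs. In a semicomplete
-- multipartite digraph z lies in the part of x exactly when neither ∂(x,z) nor ∂(z,x) is 1,
-- so every part is such a count.

open import Defs
open import Data.Bool using (Bool; true; false; _∧_; _∨_; not; if_then_else_)
open import Data.Bool.Properties using (∧-comm; ∧-idem; ∧-identityʳ; ∧-zeroʳ; ∨-zeroʳ)
  renaming (_≟_ to _≟ᵇ_)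
open import Data.Bool.ListAction using (any)
open import Data.Fin using (Fin; zero) renaming (_≟_ to _≟ᶠ_)
open import Data.List using (List; []; _∷_; filter; length; allFin)
open import Data.List.Membership.Propositional using (_∈_; find; lose)
open import Data.List.Membership.Propositional.Properties using (∈-allFin)
open import Data.List.Properties using (filter-≐; filter-some; filter-none)
open import Data.List.Relation.Unary.All.Properties using (¬Any⇒All¬)
open import Data.List.Relation.Unary.Any using (Any; any?; here; there)
open import Data.Nat using (ℕ; zero; suc; _+_; _≤_; _<_; _≡ᵇ_; z≤n) renaming (_≟_ to _≟ⁿ_)
open import Data.Nat.Induction using (<-wellFounded)
open import Data.Nat.Properties
  using (n≮n; ≤-refl; ≤-trans; ≤-reflexive; ≤-antisym; n≤1+n; +-suc; +-mono-≤; m<n+m; module ≤-Reasoning)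
open import Data.Product using (_×_; _,_; proj₁; proj₂)
open import Data.Product.Properties using (,-injective)
open import Function using (_∘_)
open import Induction.WellFounded using (Acc; acc)
open import Relation.Binary.Definitions using (DecidableEquality)
open import Relation.Binary.PropositionalEquality
  using (_≡_; _≢_; refl; sym; trans; cong; cong₂; subst; module ≡-Reasoning)
open import Relation.Nullary using (¬_; ⌊_⌋; does; yes; no; contradiction)
open import Relation.Nullary.Decidable using (map′; _×-dec_; dec-true; dec-false)

countᵇ : {A : Set} → (A → Bool) → List A → ℕ
countᵇ P xs = length (filter (λ z → P z ≟ᵇ true) xs)

module _ {A : Set} where

  countᵇ-cong : ∀ {P R : A → Bool} → (∀ z → P z ≡ R z) → ∀ xs → countᵇ P xs ≡ countᵇ R xs
  countᵇ-cong P≗R xs =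
    cong length (filter-≐ _ _ ((λ {z} → trans (sym (P≗R z))) , (λ {z} → trans (P≗R z))) xs)

  countᵇ-split : ∀ (P R : A → Bool) xs →
    countᵇ P xs ≡ countᵇ (λ z → P z ∧ R z) xs + countᵇ (λ z → P z ∧ not (R z)) xs
  countᵇ-split P R [] = refl
  countᵇ-split P R (x ∷ xs) with P x | R x
  ... | true  | true  = cong suc (countᵇ-split P R xs)
  ... | true  | false = trans (cong suc (countᵇ-split P R xs)) (sym (+-suc _ _))
  ... | false | _     = countᵇ-split P R xs

  countᵇ-pos : ∀ {P : A → Bool} {z xs} → z ∈ xs → P z ≡ true → 0 < countᵇ P xs
  countᵇ-pos z∈xs Pz = filter-some _ (lose z∈xs Pz)

  countᵇ-none : ∀ {P : A → Bool} xs → ¬ Any (λ z → P z ≡ true) xs → countᵇ P xs ≡ 0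
  countᵇ-none xs none = cong length (filter-none _ (¬Any⇒All¬ xs none))

module _ {A B : Set} (_≟_ : DecidableEquality B) (xs : List A) where

  fibre : (A → B) → B → ℕ
  fibre f c = countᵇ (λ a → does (f a ≟ c)) xs

  _∖_ : (B → Bool) → B → B → Bool
  (Q ∖ c) d = Q d ∧ not (does (d ≟ c))

  countᵇ-split-fibre : ∀ {Q : B → Bool} {c} → Q c ≡ true → ∀ f →
    countᵇ (Q ∘ f) xs ≡ fibre f c + countᵇ ((Q ∖ c) ∘ f) xs
  countᵇ-split-fibre {Q} {c} Qc f =
    trans (countᵇ-split (Q ∘ f) (λ a → does (f a ≟ c)) xs)
          (cong (_+ countᵇ ((Q ∖ c) ∘ f) xs) (countᵇ-cong (restrict ∘ f) xs))
    where
    restrict : ∀ d → Q d ∧ does (d ≟ c) ≡ does (d ≟ c)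
    restrict d with d ≟ c
    ... | yes refl = trans (∧-identityʳ (Q c)) Qc
    ... | no  _    = ∧-zeroʳ (Q d)

  countᵇ-∘-mono : ∀ {f g : A → B} → (∀ {a} → a ∈ xs → fibre f (f a) ≤ fibre g (f a)) →
    ∀ Q → countᵇ (Q ∘ f) xs ≤ countᵇ (Q ∘ g) xs
  countᵇ-∘-mono {f} {g} f≤g Q = go Q (<-wellFounded _)
    where
    go : ∀ Q → Acc _<_ (countᵇ (Q ∘ f) xs) → countᵇ (Q ∘ f) xs ≤ countᵇ (Q ∘ g) xs
    go Q (acc smaller) with any? (λ a → Q (f a) ≟ᵇ true) xs
    ... | no none = ≤-trans (≤-reflexive (countᵇ-none xs none)) z≤n
    ... | yes some with find some
    ...   | w , w∈xs , Qfw = begin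
      countᵇ (Q ∘ f) xs                   ≡⟨ split f ⟩
      fibre f c + countᵇ ((Q ∖ c) ∘ f) xs ≤⟨ +-mono-≤ (f≤g w∈xs) (go (Q ∖ c) (smaller decreasing)) ⟩
      fibre g c + countᵇ ((Q ∖ c) ∘ g) xs ≡⟨ split g ⟨
      countᵇ (Q ∘ g) xs                   ∎
      where
      open ≤-Reasoning
      c = f w
      split : ∀ h → countᵇ (Q ∘ h) xs ≡ fibre h c + countᵇ ((Q ∖ c) ∘ h) xs
      split = countᵇ-split-fibre {Q} Qfw
      decreasing : countᵇ ((Q ∖ c) ∘ f) xs < countᵇ (Q ∘ f) xs
      decreasing = subst (countᵇ ((Q ∖ c) ∘ f) xs <_) (sym (split f))
        (m<n+m _ (countᵇ-pos w∈xs (dec-true (c ≟ c) refl)))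

module _ {A : Set} (_≟_ : DecidableEquality A) (g : A → Bool) {x : A} where

  any-select⁺ : ∀ {xs} → x ∈ xs → g x ≡ true → any (λ z → ⌊ x ≟ z ⌋ ∧ g z) xs ≡ true
  any-select⁺ {_ ∷ xs} (here refl) gx with x ≟ x
  ... | yes _ = cong (_∨ any (λ z → ⌊ x ≟ z ⌋ ∧ g z) xs) gx
  ... | no x≢x = contradiction refl x≢x
  any-select⁺ {z ∷ _} (there x∈xs) gx =
    trans (cong (⌊ x ≟ z ⌋ ∧ g z ∨_) (any-select⁺ x∈xs gx)) (∨-zeroʳ _)

  any-select⁻ : ∀ xs → any (λ z → ⌊ x ≟ z ⌋ ∧ g z) xs ≡ true → g x ≡ true
  any-select⁻ (z ∷ xs) h with x ≟ z
  ... | no _ = any-select⁻ xs h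
  ... | yes refl with g x in gx
  ...   | true  = refl
  ...   | false = trans (sym gx) (any-select⁻ xs h)

-- Defs keeps the search behind ∂ private; unifying against the unfolding of ∂ names it.
mutual
  search : ∀ {n} → Digraph n → ℕ → ℕ → Fin n → Fin n → ℕ
  search = _

  ∂-off-diagonal : ∀ {m} (Γ : Digraph (suc m)) {x y} → x ≢ y → ∂ Γ x y ≡ search Γ 1 m x y
  ∂-off-diagonal {m} Γ {x} {y} x≢y with x ≟ᶠ y
  ... | yes x≡y = contradiction x≡y x≢y
  ... | no _ with suc m | Γ | x | y | 1
  ...   | _ | _ | _ | _ | _ = refl

module _ {n} (Γ : Digraph n) where

  search-≥ : ∀ j f x y → j ≤ search Γ j f x y
  search-≥ j zero    x y = ≤-refl
  search-≥ j (suc f) x y with reachIn Γ j x y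
  ... | true  = ≤-refl
  ... | false = ≤-trans (n≤1+n j) (search-≥ (suc j) f x y)

  search-hit⁺ : ∀ {j f x y} → reachIn Γ j x y ≡ true → search Γ j (suc f) x y ≡ j
  search-hit⁺ {j} {f} {x} {y} = cong (λ b → if b then j else search Γ (suc j) f x y)

  search-hit⁻ : ∀ {j f x y} → search Γ j (suc f) x y ≡ j → reachIn Γ j x y ≡ true
  search-hit⁻ {j} {f} {x} {y} found with reachIn Γ j x y
  ... | true  = refl
  ... | false = contradiction (subst (suc j ≤_) found (search-≥ (suc j) f x y)) (n≮n j)

  arc⇒≢ : ∀ {x y} → arc Γ x y ≡ true → x ≢ y
  arc⇒≢ {x} xy refl = contradiction (trans (sym xy) (loopless Γ x)) λ ()

  arc⇒reachIn-1 : ∀ {x y} → arc Γ x y ≡ true → reachIn Γ 1 x y ≡ true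
  arc⇒reachIn-1 {x} {y} xy =
    trans (cong (⌊ x ≟ᶠ y ⌋ ∨_) (any-select⁺ _≟ᶠ_ (λ z → arc Γ z y) (∈-allFin x) xy)) (∨-zeroʳ _)

  reachIn-1⇒arc : ∀ {x y} → x ≢ y → reachIn Γ 1 x y ≡ true → arc Γ x y ≡ true
  reachIn-1⇒arc {x} {y} x≢y r with x ≟ᶠ y
  ... | yes x≡y = contradiction x≡y x≢y
  ... | no _    = any-select⁻ _≟ᶠ_ (λ z → arc Γ z y) (allFin n) r

∂-refl : ∀ {n} (Γ : Digraph n) x → ∂ Γ x x ≡ 0
∂-refl {suc _} Γ x with x ≟ᶠ x
... | yes _   = refl
... | no x≢x = contradiction refl x≢x

arc⇒∂≡1 : ∀ {n} (Γ : Digraph n) {x y} → arc Γ x y ≡ true → ∂ Γ x y ≡ 1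
arc⇒∂≡1 {suc zero} Γ {zero} {zero} xy = contradiction refl (arc⇒≢ Γ xy)
arc⇒∂≡1 {suc (suc m)} Γ xy =
  trans (∂-off-diagonal Γ (arc⇒≢ Γ xy)) (search-hit⁺ Γ {f = m} (arc⇒reachIn-1 Γ xy))

∂≡1⇒arc : ∀ {n} (Γ : Digraph n) {x y} → ∂ Γ x y ≡ 1 → arc Γ x y ≡ true
∂≡1⇒arc Γ {x} {y} ∂≡1 with x ≟ᶠ y
... | yes refl = contradiction (trans (sym ∂≡1) (∂-refl Γ x)) λ ()
∂≡1⇒arc {suc zero} Γ {zero} {zero} ∂≡1 | no x≢y = contradiction refl x≢y
∂≡1⇒arc {suc (suc m)} Γ ∂≡1 | no x≢y =
  reachIn-1⇒arc Γ x≢y (search-hit⁻ Γ {f = m} (trans (sym (∂-off-diagonal Γ x≢y)) ∂≡1))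

∂≡ᵇ1 : ∀ {n} (Γ : Digraph n) x y → (∂ Γ x y ≡ᵇ 1) ≡ arc Γ x y
∂≡ᵇ1 Γ x y with arc Γ x y in xy
... | true  = cong (_≡ᵇ 1) (arc⇒∂≡1 Γ xy)
... | false = dec-false (∂ Γ x y ≟ⁿ 1) λ ∂≡1 →
  contradiction (trans (sym (∂≡1⇒arc Γ ∂≡1)) xy) λ ()

adjacentᵇ : ℕ × ℕ → Bool
adjacentᵇ (i , j) = (i ≡ᵇ 1) ∨ (j ≡ᵇ 1)

adjacentᵇ-∂̃ : ∀ {n} (Γ : Digraph n) x y → adjacentᵇ (∂̃ Γ x y) ≡ arc Γ x y ∨ arc Γ y x
adjacentᵇ-∂̃ Γ x y = cong₂ _∨_ (∂≡ᵇ1 Γ x y) (∂≡ᵇ1 Γ y x)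

-- Chosen so that `does (i ≟ᵖ j)` computes to Defs' `i ≡ᵖ j`.
_≟ᵖ_ : DecidableEquality (ℕ × ℕ)
(a , b) ≟ᵖ (c , d) = map′ (λ (a≡c , b≡d) → cong₂ _,_ a≡c b≡d) ,-injective (a ≟ⁿ c ×-dec b ≟ⁿ d)

module _ {n} (Γ : Digraph n) where

  valency : Fin n → ℕ × ℕ → ℕ
  valency x = fibre _≟ᵖ_ (allFin n) (∂̃ Γ x)

  p-diagonal : ∀ i j x → p Γ (i , j) (j , i) x x ≡ valency x (i , j)
  p-diagonal i j x = countᵇ-cong (λ z → ∧-swap-idem (∂ Γ x z ≡ᵇ i) (∂ Γ z x ≡ᵇ j)) (allFin n)
    where
    ∧-swap-idem : ∀ a b → (a ∧ b) ∧ (b ∧ a) ≡ a ∧ b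
    ∧-swap-idem a b = trans (cong ((a ∧ b) ∧_) (∧-comm b a)) (∧-idem (a ∧ b))

  valency-uniform : WeaklyDistanceRegular Γ →
    ∀ u v x y → valency x (∂̃ Γ u v) ≡ valency y (∂̃ Γ u v)
  valency-uniform (_ , _ , wdr) u v x y = begin
    valency x (∂̃ Γ u v)         ≡⟨ p-diagonal (∂ Γ u v) (∂ Γ v u) x ⟨
    p Γ (∂̃ Γ u v) (∂̃ Γ v u) x x ≡⟨ wdr u v v u x x y y (cong₂ _,_ ∂xx≡∂yy ∂xx≡∂yy) ⟩
    p Γ (∂̃ Γ u v) (∂̃ Γ v u) y y ≡⟨ p-diagonal (∂ Γ u v) (∂ Γ v u) y ⟩
    valency y (∂̃ Γ u v)         ∎
    where
    open ≡-Reasoning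
    ∂xx≡∂yy : ∂ Γ x x ≡ ∂ Γ y y
    ∂xx≡∂yy = trans (∂-refl Γ x) (sym (∂-refl Γ y))

  count-∂̃-uniform : WeaklyDistanceRegular Γ → ∀ x y (Q : ℕ × ℕ → Bool) →
    count Γ (Q ∘ ∂̃ Γ x) ≡ count Γ (Q ∘ ∂̃ Γ y)
  count-∂̃-uniform wdr x y Q = ≤-antisym (mono x y) (mono y x)
    where
    mono : ∀ x y → count Γ (Q ∘ ∂̃ Γ x) ≤ count Γ (Q ∘ ∂̃ Γ y)
    mono x y = countᵇ-∘-mono _≟ᵖ_ (allFin n)
      (λ {w} _ → ≤-reflexive (valency-uniform wdr x w x y)) Q

  partSize-∂̃ : ∀ {k} {part : Fin n → Fin k} →
    (∀ x y → (Adj Γ x y → part x ≢ part y) × (part x ≢ part y → Adj Γ x y)) →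
    ∀ y → partSize Γ part (part y) ≡ count Γ (not ∘ adjacentᵇ ∘ ∂̃ Γ y)
  partSize-∂̃ {part = part} multipartite y = countᵇ-cong samePart (allFin n)
    where
    samePart : ∀ z → ⌊ part z ≟ᶠ part y ⌋ ≡ not (adjacentᵇ (∂̃ Γ y z))
    samePart z rewrite adjacentᵇ-∂̃ Γ y z with part z ≟ᶠ part y | arc Γ y z ∨ arc Γ z y in adj
    ... | yes same | true  = contradiction (sym same) (proj₁ (multipartite y z) adj)
    ... | yes _    | false = refl
    ... | no apart | _     = cong not (trans (sym (proj₂ (multipartite y z) (apart ∘ sym))) adj)

lemma4p1 : ∀ {n} (Γ : Digraph n) →
    WeaklyDistanceRegular Γ → Commutative Γ →
    ∀ (k : ℕ) (part : Fin n → Fin k) → IsMultipartition Γ k part →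
    ∀ a b → partSize Γ part a ≡ partSize Γ part b
lemma4p1 Γ wdr _ k part (_ , inhabited , multipartite) a b
  with ya , _ , _ , refl , _ ← inhabited a
     | yb , _ , _ , refl , _ ← inhabited b = begin
  partSize Γ part (part ya)          ≡⟨ partSize-∂̃ Γ multipartite ya ⟩
  count Γ (not ∘ adjacentᵇ ∘ ∂̃ Γ ya) ≡⟨ count-∂̃-uniform Γ wdr ya yb (not ∘ adjacentᵇ) ⟩
  count Γ (not ∘ adjacentᵇ ∘ ∂̃ Γ yb) ≡⟨ partSize-∂̃ Γ multipartite yb ⟨
  partSize Γ part (part yb)          ∎
  where open ≡-Reasoning
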